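{- For $n\ge0$ let $\mathcal{D}_n(x)=\sum_{k=0}^n\binom{n}{k}k!\,(x-1)^{n-k}$ be the $n$-th derangement polynomial and $\mathcal{D}_n=\mathcal{D}_n(0)$ the number of derangements of $n$ elements. Let $n\ge1$, $s\ge1$, $m\ge0$ be integers and $p\ge3$ a prime. Then $$\mathcal{D}_{n+mp^s}(x)\equiv\left(x^{p^s}-1\right)^m\mathcal{D}_n(x)\pmod p.$$ In particular $\mathcal{D}_{n+mp^s}\equiv(-1)^m\mathcal{D}_n\pmod p$, and for every integer $q$ with $p\nmid q-1$, $\mathcal{D}_{n+mp(p-1)}(q)\equiv\mathcal{D}_n(q)\pmod p$. Moreover, for every integer $n\ge3$, $$\mathcal{D}_n(x)=\sum_{i=1}^{n-3}(n-i)\,\mathcal{D}_{n-i}(x)+3\,\mathcal{D}_2(x)+\sum_{i=3}^n(x-1)^i.$$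
   Context: A congruence $P(x)\equiv Q(x)\pmod p$ between polynomials with integer coefficients means that every coefficient of $P(x)-Q(x)$ is divisible by $p$. Equivalently $\mathcal{D}_n(x)=\sum_{k=0}^n\binom nk\mathcal{D}_{n-k}x^k$, with exponential generating function $\sum_n\mathcal{D}_n(x)\frac{t^n}{n!}=\frac{e^{ -t}}{1-t}e^{xt}$. -}

module Defs where

open import Data.Nat as ℕ using (ℕ; zero; suc; _!)
open import Data.Nat.Combinatorics using (_C_)
open import Data.Integer as ℤ using (ℤ; +_; 0ℤ; 1ℤ)
open import Data.Integer.Divisibility using (_∣_)
open import Data.List using (List; []; _∷_)
open import Relation.Binary.PropositionalEquality using (_≡_)

-- Polynomials with integer coefficients, as coefficient lists
-- (lowest degree first). Trailing zeros are allowed; polynomials are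
-- compared coefficientwise via `coeff`.
Poly : Set
Poly = List ℤ

coeff : Poly → ℕ → ℤ
coeff []       _       = 0ℤ
coeff (a ∷ _)  zero    = a
coeff (_ ∷ as) (suc k) = coeff as k

infixl 6 _+ₚ_ _-ₚ_
infixl 7 _*ₚ_ _·ₚ_
infixr 8 _^ₚ_

_+ₚ_ : Poly → Poly → Poly
[]       +ₚ q        = q
(a ∷ p)  +ₚ []       = a ∷ p
(a ∷ p)  +ₚ (b ∷ q)  = (a ℤ.+ b) ∷ (p +ₚ q)

_·ₚ_ : ℤ → Poly → Poly
c ·ₚ []      = []
c ·ₚ (a ∷ p) = (c ℤ.* a) ∷ (c ·ₚ p)

negₚ : Poly → Poly
negₚ p = ℤ.-1ℤ ·ₚ p

_-ₚ_ : Poly → Poly → Poly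
p -ₚ q = p +ₚ negₚ q

_*ₚ_ : Poly → Poly → Poly
[]      *ₚ q = []
(a ∷ p) *ₚ q = (a ·ₚ q) +ₚ (0ℤ ∷ (p *ₚ q))

constₚ : ℤ → Poly
constₚ c = c ∷ []

X : Poly
X = 0ℤ ∷ 1ℤ ∷ []

_^ₚ_ : Poly → ℕ → Poly
p ^ₚ zero  = constₚ 1ℤ
p ^ₚ suc n = p *ₚ (p ^ₚ n)

eval : Poly → ℤ → ℤ
eval []      _ = 0ℤ
eval (a ∷ p) q = a ℤ.+ q ℤ.* eval p q

sumFrom : ℕ → ℕ → (ℕ → Poly) → Poly
sumFrom a zero      f = []
sumFrom a (suc len) f = f a +ₚ sumFrom (suc a) len f

-- Σ_{i=a}^{b} f i  (empty if b < a)
sumRange : ℕ → ℕ → (ℕ → Poly) → Poly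
sumRange a b f = sumFrom a (suc b ℕ.∸ a) f

Der : ℕ → Poly
Der n = sumRange 0 n (λ k → (+ ((n C k) ℕ.* (k !))) ·ₚ ((X -ₚ constₚ 1ℤ) ^ₚ (n ℕ.∸ k)))

derNum : ℕ → ℤ
derNum n = eval (Der n) 0ℤ

_≐_ : Poly → Poly → Set
P ≐ Q = ∀ k → coeff P k ≡ coeff Q k

_≡ₚ_[mod_] : Poly → Poly → ℕ → Set
P ≡ₚ Q [mod p ] = ∀ k → (+ p) ∣ coeff (P -ₚ Q) k

_≡ᵢ_[mod_] : ℤ → ℤ → ℕ → Set
a ≡ᵢ b [mod p ] = (+ p) ∣ (a ℤ.- b)

{-# OPTIONS --safe #-}
module Submission where

-- The derangement polynomials satisfy D_{n+1} = (x-1)^{n+1} + (n+1) D_n.  If d divides M, the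
-- factor n+M+1 may be replaced by n+1 modulo d, so induction on n gives D_{n+M} ≡ (x-1)^M D_n and
-- hence D_{n+mM} ≡ ((x-1)^M)^m D_n.  For an odd prime p, p divides every inner binomial coefficient
-- of (x-1)^{p^s} and (-1)^{p^s} = -1, so (x-1)^{p^s} ≡ x^{p^s} - 1 (mod p): this is the first
-- congruence, and evaluating at 0 gives the second.  Evaluating (x-1)^p ≡ x^p - 1 at the integers
-- yields Fermat's little theorem, by which (q^p - 1)^{p-1} ≡ 1 when p ∤ q - 1; this gives the third.
-- Unrolling the recurrence down to D_2 gives the final identity.

open import Defs
open import Data.Nat using (ℕ; _+_; _*_; _^_; _∸_; _≤_)
open import Data.Nat.Primality using (Prime)
open import Data.Integer using (ℤ; +_; -1ℤ; 1ℤ) renaming (_^_ to _^ℤ_; _-_ to _-ℤ_; _*_ to _*ℤ_)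
open import Data.Integer.Divisibility using (_∣_)
open import Data.Product using (_×_)
open import Relation.Nullary using (¬_)

open import Data.Nat using (zero; suc; _<_; s≤s; z≤n; _!; NonZero)
import Data.Nat.Properties as ℕ
open import Data.Nat.Combinatorics using (_C_; nC1≡n; nCn≡1; nCk+nC[k+1]≡[n+1]C[k+1]; k>n⇒nCk≡0)
open import Data.Nat.Divisibility as ℕ∣ using () renaming (_∣_ to _∣ℕ_)
open import Data.Nat.Primality using (euclidsLemma; prime[2]; prime⇒nonZero; composite)
import Data.Nat.Tactic.RingSolver as ℕ-Solver
open import Data.Integer using (0ℤ; -[1+_]; ∣_∣) renaming (_+_ to _+ℤ_)
import Data.Integer.Properties as ℤ
open import Data.Integer.Divisibility.Signed as Signed using () renaming (_∣_ to _∣ₛ_)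
open import Data.Integer.Tactic.RingSolver using (solve-∀)
open import Data.List using ([]; _∷_)
open import Data.Fin using () renaming (zero to #0; suc to #suc)
import Data.Vec as Vec
open import Data.Product using (_,_)
open import Data.Sum using (inj₁; inj₂; [_,_]′)
open import Data.Empty using (⊥-elim)
open import Function using (_∘_)
open import Level using (0ℓ)
open import Relation.Nullary using (yes; no)
open import Relation.Binary.Definitions using (tri<; tri≈; tri>)
open import Relation.Binary.Bundles using (Setoid)
open import Relation.Binary.Structures using (IsEquivalence)
open import Relation.Binary.PropositionalEquality
import Relation.Binary.Reasoning.Setoid as SetoidReasoning
open import Algebra.Bundles using (CommutativeMonoid)
import Algebra.Properties.CommutativeSemigroup as CommSemigroupProperties
import Algebra.Solver.CommutativeMonoid as CommMonoidSolver

coeff-+ : ∀ P Q k → coeff (P +ₚ Q) k ≡ coeff P k +ℤ coeff Q k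
coeff-+ []      Q       k       = sym (ℤ.+-identityˡ _)
coeff-+ (a ∷ P) []      k       = sym (ℤ.+-identityʳ _)
coeff-+ (a ∷ P) (b ∷ Q) zero    = refl
coeff-+ (a ∷ P) (b ∷ Q) (suc k) = coeff-+ P Q k

coeff-· : ∀ c P k → coeff (c ·ₚ P) k ≡ c *ℤ coeff P k
coeff-· c []      k       = sym (ℤ.*-zeroʳ c)
coeff-· c (a ∷ P) zero    = refl
coeff-· c (a ∷ P) (suc k) = coeff-· c P k

coeff-- : ∀ P Q k → coeff (P -ₚ Q) k ≡ coeff P k -ℤ coeff Q k
coeff-- P Q k = begin
  coeff (P +ₚ negₚ Q) k          ≡⟨ coeff-+ P (negₚ Q) k ⟩
  coeff P k +ℤ coeff (negₚ Q) k  ≡⟨ cong (coeff P k +ℤ_) (coeff-· -1ℤ Q k) ⟩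
  coeff P k +ℤ -1ℤ *ℤ coeff Q k  ≡⟨ cong (coeff P k +ℤ_) (ℤ.-1*i≡-i (coeff Q k)) ⟩
  coeff P k -ℤ coeff Q k         ∎
  where open ≡-Reasoning


infix 4 _≈_
record _≈_ (P Q : Poly) : Set where
  constructor coeffwise
  field coeff-≡ : ∀ k → coeff P k ≡ coeff Q k
open _≈_ public

≈-isEquivalence : IsEquivalence _≈_
≈-isEquivalence = record
  { refl  = coeffwise λ k → refl
  ; sym   = λ P≈Q → coeffwise λ k → sym (coeff-≡ P≈Q k)
  ; trans = λ P≈Q Q≈R → coeffwise λ k → trans (coeff-≡ P≈Q k) (coeff-≡ Q≈R k)
  }

≈-setoid : Setoid 0ℓ 0ℓ
≈-setoid = record { isEquivalence = ≈-isEquivalence }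

open IsEquivalence ≈-isEquivalence public
  using () renaming (refl to ≈-refl; sym to ≈-sym; trans to ≈-trans; reflexive to ≈-reflexive)

module ≈-Reasoning = SetoidReasoning ≈-setoid

∷-cong : ∀ a {P Q} → P ≈ Q → (a ∷ P) ≈ (a ∷ Q)
∷-cong a P≈Q = coeffwise λ { zero → refl ; (suc k) → coeff-≡ P≈Q k }

[0]≈[] : (0ℤ ∷ []) ≈ []
[0]≈[] = coeffwise λ { zero → refl ; (suc k) → refl }

+ₚ-cong : ∀ {P P′ Q Q′} → P ≈ P′ → Q ≈ Q′ → (P +ₚ Q) ≈ (P′ +ₚ Q′)
+ₚ-cong {P} {P′} {Q} {Q′} P≈P′ Q≈Q′ = coeffwise λ k → begin
  coeff (P +ₚ Q) k              ≡⟨ coeff-+ P Q k ⟩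
  coeff P k +ℤ coeff Q k        ≡⟨ cong₂ _+ℤ_ (coeff-≡ P≈P′ k) (coeff-≡ Q≈Q′ k) ⟩
  coeff P′ k +ℤ coeff Q′ k      ≡⟨ coeff-+ P′ Q′ k ⟨
  coeff (P′ +ₚ Q′) k            ∎
  where open ≡-Reasoning

+ₚ-congˡ : ∀ P {Q Q′} → Q ≈ Q′ → (P +ₚ Q) ≈ (P +ₚ Q′)
+ₚ-congˡ P = +ₚ-cong ≈-refl

+ₚ-comm : ∀ P Q → (P +ₚ Q) ≈ (Q +ₚ P)
+ₚ-comm P Q = coeffwise λ k → begin
  coeff (P +ₚ Q) k        ≡⟨ coeff-+ P Q k ⟩
  coeff P k +ℤ coeff Q k  ≡⟨ ℤ.+-comm (coeff P k) (coeff Q k) ⟩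
  coeff Q k +ℤ coeff P k  ≡⟨ coeff-+ Q P k ⟨
  coeff (Q +ₚ P) k        ∎
  where open ≡-Reasoning

+ₚ-assoc : ∀ P Q R → ((P +ₚ Q) +ₚ R) ≈ (P +ₚ (Q +ₚ R))
+ₚ-assoc P Q R = coeffwise λ k → begin
  coeff ((P +ₚ Q) +ₚ R) k                   ≡⟨ coeff-+ (P +ₚ Q) R k ⟩
  coeff (P +ₚ Q) k +ℤ coeff R k             ≡⟨ cong (_+ℤ coeff R k) (coeff-+ P Q k) ⟩
  (coeff P k +ℤ coeff Q k) +ℤ coeff R k     ≡⟨ ℤ.+-assoc (coeff P k) (coeff Q k) (coeff R k) ⟩
  coeff P k +ℤ (coeff Q k +ℤ coeff R k)     ≡⟨ cong (coeff P k +ℤ_) (coeff-+ Q R k) ⟨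
  coeff P k +ℤ coeff (Q +ₚ R) k             ≡⟨ coeff-+ P (Q +ₚ R) k ⟨
  coeff (P +ₚ (Q +ₚ R)) k                   ∎
  where open ≡-Reasoning

+ₚ-identityʳ : ∀ P → (P +ₚ []) ≈ P
+ₚ-identityʳ []      = ≈-refl
+ₚ-identityʳ (a ∷ P) = ≈-refl

+ₚ-commutativeMonoid : CommutativeMonoid 0ℓ 0ℓ
+ₚ-commutativeMonoid = record
  { Carrier = Poly
  ; _≈_ = _≈_
  ; _∙_ = _+ₚ_
  ; ε = []
  ; isCommutativeMonoid = record
    { isMonoid = record
      { isSemigroup = record
        { isMagma = record { isEquivalence = ≈-isEquivalence ; ∙-cong = +ₚ-cong }
        ; assoc = +ₚ-assoc
        }
      ; identity = (λ P → ≈-refl) , +ₚ-identityʳ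
      }
    ; comm = +ₚ-comm
    }
  }

open CommSemigroupProperties (CommutativeMonoid.commutativeSemigroup +ₚ-commutativeMonoid)
  using (interchange)

·ₚ-congʳ : ∀ c {P Q} → P ≈ Q → (c ·ₚ P) ≈ (c ·ₚ Q)
·ₚ-congʳ c {P} {Q} P≈Q = coeffwise λ k → begin
  coeff (c ·ₚ P) k  ≡⟨ coeff-· c P k ⟩
  c *ℤ coeff P k    ≡⟨ cong (c *ℤ_) (coeff-≡ P≈Q k) ⟩
  c *ℤ coeff Q k    ≡⟨ coeff-· c Q k ⟨
  coeff (c ·ₚ Q) k  ∎
  where open ≡-Reasoning

·ₚ-distribˡ : ∀ c P Q → (c ·ₚ (P +ₚ Q)) ≈ ((c ·ₚ P) +ₚ (c ·ₚ Q))
·ₚ-distribˡ c P Q = coeffwise λ k → begin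
  coeff (c ·ₚ (P +ₚ Q)) k                    ≡⟨ coeff-· c (P +ₚ Q) k ⟩
  c *ℤ coeff (P +ₚ Q) k                      ≡⟨ cong (c *ℤ_) (coeff-+ P Q k) ⟩
  c *ℤ (coeff P k +ℤ coeff Q k)              ≡⟨ ℤ.*-distribˡ-+ c (coeff P k) (coeff Q k) ⟩
  c *ℤ coeff P k +ℤ c *ℤ coeff Q k           ≡⟨ cong₂ _+ℤ_ (coeff-· c P k) (coeff-· c Q k) ⟨
  coeff (c ·ₚ P) k +ℤ coeff (c ·ₚ Q) k       ≡⟨ coeff-+ (c ·ₚ P) (c ·ₚ Q) k ⟨
  coeff ((c ·ₚ P) +ₚ (c ·ₚ Q)) k             ∎
  where open ≡-Reasoning

·ₚ-distribʳ : ∀ a b P → ((a +ℤ b) ·ₚ P) ≈ ((a ·ₚ P) +ₚ (b ·ₚ P))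
·ₚ-distribʳ a b P = coeffwise λ k → begin
  coeff ((a +ℤ b) ·ₚ P) k                    ≡⟨ coeff-· (a +ℤ b) P k ⟩
  (a +ℤ b) *ℤ coeff P k                      ≡⟨ ℤ.*-distribʳ-+ (coeff P k) a b ⟩
  a *ℤ coeff P k +ℤ b *ℤ coeff P k           ≡⟨ cong₂ _+ℤ_ (coeff-· a P k) (coeff-· b P k) ⟨
  coeff (a ·ₚ P) k +ℤ coeff (b ·ₚ P) k       ≡⟨ coeff-+ (a ·ₚ P) (b ·ₚ P) k ⟨
  coeff ((a ·ₚ P) +ₚ (b ·ₚ P)) k             ∎
  where open ≡-Reasoning

·ₚ-assoc : ∀ a b P → (a ·ₚ (b ·ₚ P)) ≈ ((a *ℤ b) ·ₚ P)
·ₚ-assoc a b P = coeffwise λ k → begin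
  coeff (a ·ₚ (b ·ₚ P)) k   ≡⟨ coeff-· a (b ·ₚ P) k ⟩
  a *ℤ coeff (b ·ₚ P) k     ≡⟨ cong (a *ℤ_) (coeff-· b P k) ⟩
  a *ℤ (b *ℤ coeff P k)     ≡⟨ ℤ.*-assoc a b (coeff P k) ⟨
  (a *ℤ b) *ℤ coeff P k     ≡⟨ coeff-· (a *ℤ b) P k ⟨
  coeff ((a *ℤ b) ·ₚ P) k   ∎
  where open ≡-Reasoning

·ₚ-identityˡ : ∀ P → (1ℤ ·ₚ P) ≈ P
·ₚ-identityˡ P = coeffwise λ k → trans (coeff-· 1ℤ P k) (ℤ.*-identityˡ (coeff P k))

·ₚ-zeroˡ : ∀ P → (0ℤ ·ₚ P) ≈ []
·ₚ-zeroˡ P = coeffwise λ k → coeff-· 0ℤ P k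

·ₚ-0∷ : ∀ c P → (c ·ₚ (0ℤ ∷ P)) ≈ (0ℤ ∷ (c ·ₚ P))
·ₚ-0∷ c P = coeffwise λ { zero → ℤ.*-zeroʳ c ; (suc k) → refl }

·ₚ-comm : ∀ a b P → (a ·ₚ (b ·ₚ P)) ≈ (b ·ₚ (a ·ₚ P))
·ₚ-comm a b P = begin
  a ·ₚ (b ·ₚ P)   ≈⟨ ·ₚ-assoc a b P ⟩
  (a *ℤ b) ·ₚ P   ≡⟨ cong (_·ₚ P) (ℤ.*-comm a b) ⟩
  (b *ℤ a) ·ₚ P   ≈⟨ ·ₚ-assoc b a P ⟨
  b ·ₚ (a ·ₚ P)   ∎
  where open ≈-Reasoning

0∷-*ₚ : ∀ P Q → ((0ℤ ∷ P) *ₚ Q) ≈ (0ℤ ∷ (P *ₚ Q))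
0∷-*ₚ P Q = +ₚ-cong (·ₚ-zeroˡ Q) ≈-refl

*ₚ-congˡ : ∀ A {P Q} → P ≈ Q → (A *ₚ P) ≈ (A *ₚ Q)
*ₚ-congˡ []      P≈Q = ≈-refl
*ₚ-congˡ (a ∷ A) P≈Q = +ₚ-cong (·ₚ-congʳ a P≈Q) (∷-cong 0ℤ (*ₚ-congˡ A P≈Q))

*ₚ-identityˡ : ∀ P → (constₚ 1ℤ *ₚ P) ≈ P
*ₚ-identityˡ P = ≈-trans (+ₚ-cong (·ₚ-identityˡ P) [0]≈[]) (+ₚ-identityʳ P)

*ₚ-identityʳ : ∀ P → (P *ₚ constₚ 1ℤ) ≈ P
*ₚ-identityʳ []      = ≈-refl
*ₚ-identityʳ (a ∷ P) = coeffwise λ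
  { zero    → trans (ℤ.+-identityʳ (a *ℤ 1ℤ)) (ℤ.*-identityʳ a)
  ; (suc k) → coeff-≡ (*ₚ-identityʳ P) k
  }

*ₚ-distribˡ : ∀ A B C → (A *ₚ (B +ₚ C)) ≈ ((A *ₚ B) +ₚ (A *ₚ C))
*ₚ-distribˡ []      B C = ≈-refl
*ₚ-distribˡ (a ∷ A) B C = begin
  a ·ₚ (B +ₚ C) +ₚ (0ℤ ∷ (A *ₚ (B +ₚ C)))
    ≈⟨ +ₚ-cong (·ₚ-distribˡ a B C) (∷-cong 0ℤ (*ₚ-distribˡ A B C)) ⟩
  (a ·ₚ B +ₚ a ·ₚ C) +ₚ ((0ℤ ∷ (A *ₚ B)) +ₚ (0ℤ ∷ (A *ₚ C)))
    ≈⟨ interchange (a ·ₚ B) (a ·ₚ C) (0ℤ ∷ (A *ₚ B)) (0ℤ ∷ (A *ₚ C)) ⟩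
  (a ·ₚ B +ₚ (0ℤ ∷ (A *ₚ B))) +ₚ (a ·ₚ C +ₚ (0ℤ ∷ (A *ₚ C)))
    ∎
  where open ≈-Reasoning

*ₚ-distribʳ : ∀ A B C → ((A +ₚ B) *ₚ C) ≈ ((A *ₚ C) +ₚ (B *ₚ C))
*ₚ-distribʳ []      B       C = ≈-refl
*ₚ-distribʳ (a ∷ A) []      C = ≈-sym (+ₚ-identityʳ ((a ∷ A) *ₚ C))
*ₚ-distribʳ (a ∷ A) (b ∷ B) C = begin
  (a +ℤ b) ·ₚ C +ₚ (0ℤ ∷ ((A +ₚ B) *ₚ C))
    ≈⟨ +ₚ-cong (·ₚ-distribʳ a b C) (∷-cong 0ℤ (*ₚ-distribʳ A B C)) ⟩
  (a ·ₚ C +ₚ b ·ₚ C) +ₚ ((0ℤ ∷ (A *ₚ C)) +ₚ (0ℤ ∷ (B *ₚ C)))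
    ≈⟨ interchange (a ·ₚ C) (b ·ₚ C) (0ℤ ∷ (A *ₚ C)) (0ℤ ∷ (B *ₚ C)) ⟩
  (a ·ₚ C +ₚ (0ℤ ∷ (A *ₚ C))) +ₚ (b ·ₚ C +ₚ (0ℤ ∷ (B *ₚ C)))
    ∎
  where open ≈-Reasoning

·ₚ-*ₚ-assoc : ∀ c B C → ((c ·ₚ B) *ₚ C) ≈ (c ·ₚ (B *ₚ C))
·ₚ-*ₚ-assoc c []      C = ≈-refl
·ₚ-*ₚ-assoc c (b ∷ B) C = begin
  (c *ℤ b) ·ₚ C +ₚ (0ℤ ∷ ((c ·ₚ B) *ₚ C))
    ≈⟨ +ₚ-cong (≈-sym (·ₚ-assoc c b C)) (∷-cong 0ℤ (·ₚ-*ₚ-assoc c B C)) ⟩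
  c ·ₚ (b ·ₚ C) +ₚ (0ℤ ∷ (c ·ₚ (B *ₚ C)))
    ≈⟨ +ₚ-congˡ (c ·ₚ (b ·ₚ C)) (·ₚ-0∷ c (B *ₚ C)) ⟨
  c ·ₚ (b ·ₚ C) +ₚ c ·ₚ (0ℤ ∷ (B *ₚ C))
    ≈⟨ ·ₚ-distribˡ c (b ·ₚ C) (0ℤ ∷ (B *ₚ C)) ⟨
  c ·ₚ (b ·ₚ C +ₚ (0ℤ ∷ (B *ₚ C)))
    ∎
  where open ≈-Reasoning

*ₚ-·ₚ-comm : ∀ A c B → (A *ₚ (c ·ₚ B)) ≈ (c ·ₚ (A *ₚ B))
*ₚ-·ₚ-comm []      c B = ≈-refl
*ₚ-·ₚ-comm (a ∷ A) c B = begin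
  a ·ₚ (c ·ₚ B) +ₚ (0ℤ ∷ (A *ₚ (c ·ₚ B)))
    ≈⟨ +ₚ-cong (·ₚ-comm a c B) (∷-cong 0ℤ (*ₚ-·ₚ-comm A c B)) ⟩
  c ·ₚ (a ·ₚ B) +ₚ (0ℤ ∷ (c ·ₚ (A *ₚ B)))
    ≈⟨ +ₚ-congˡ (c ·ₚ (a ·ₚ B)) (·ₚ-0∷ c (A *ₚ B)) ⟨
  c ·ₚ (a ·ₚ B) +ₚ c ·ₚ (0ℤ ∷ (A *ₚ B))
    ≈⟨ ·ₚ-distribˡ c (a ·ₚ B) (0ℤ ∷ (A *ₚ B)) ⟨
  c ·ₚ (a ·ₚ B +ₚ (0ℤ ∷ (A *ₚ B)))
    ∎
  where open ≈-Reasoning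

*ₚ-assoc : ∀ A B C → ((A *ₚ B) *ₚ C) ≈ (A *ₚ (B *ₚ C))
*ₚ-assoc []      B C = ≈-refl
*ₚ-assoc (a ∷ A) B C = begin
  (a ·ₚ B +ₚ (0ℤ ∷ (A *ₚ B))) *ₚ C
    ≈⟨ *ₚ-distribʳ (a ·ₚ B) (0ℤ ∷ (A *ₚ B)) C ⟩
  (a ·ₚ B) *ₚ C +ₚ (0ℤ ∷ (A *ₚ B)) *ₚ C
    ≈⟨ +ₚ-cong (·ₚ-*ₚ-assoc a B C) (0∷-*ₚ (A *ₚ B) C) ⟩
  a ·ₚ (B *ₚ C) +ₚ (0ℤ ∷ ((A *ₚ B) *ₚ C))
    ≈⟨ +ₚ-congˡ (a ·ₚ (B *ₚ C)) (∷-cong 0ℤ (*ₚ-assoc A B C)) ⟩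
  a ·ₚ (B *ₚ C) +ₚ (0ℤ ∷ (A *ₚ (B *ₚ C)))
    ∎
  where open ≈-Reasoning

^ₚ-distribˡ-+-*ₚ : ∀ P m n → (P ^ₚ (m + n)) ≈ ((P ^ₚ m) *ₚ (P ^ₚ n))
^ₚ-distribˡ-+-*ₚ P zero    n = ≈-sym (*ₚ-identityˡ (P ^ₚ n))
^ₚ-distribˡ-+-*ₚ P (suc m) n = begin
  P *ₚ P ^ₚ (m + n)            ≈⟨ *ₚ-congˡ P (^ₚ-distribˡ-+-*ₚ P m n) ⟩
  P *ₚ (P ^ₚ m *ₚ P ^ₚ n)      ≈⟨ *ₚ-assoc P (P ^ₚ m) (P ^ₚ n) ⟨
  (P *ₚ P ^ₚ m) *ₚ P ^ₚ n      ∎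
  where open ≈-Reasoning

X-1 : Poly
X-1 = X -ₚ constₚ 1ℤ

sumFrom-cong : ∀ a l {f g} → (∀ i → f i ≈ g i) → sumFrom a l f ≈ sumFrom a l g
sumFrom-cong a zero    f≈g = ≈-refl
sumFrom-cong a (suc l) f≈g = +ₚ-cong (f≈g a) (sumFrom-cong (suc a) l f≈g)

sumFrom-shift : ∀ a l f → sumFrom (suc a) l f ≡ sumFrom a l (λ i → f (suc i))
sumFrom-shift a zero    f = refl
sumFrom-shift a (suc l) f = cong (f (suc a) +ₚ_) (sumFrom-shift (suc a) l f)

sumFrom-·ₚ : ∀ a l c f → sumFrom a l (λ i → c ·ₚ f i) ≈ (c ·ₚ sumFrom a l f)
sumFrom-·ₚ a zero    c f = ≈-refl
sumFrom-·ₚ a (suc l) c f = ≈-trans (+ₚ-congˡ (c ·ₚ f a) (sumFrom-·ₚ (suc a) l c f))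
                                   (≈-sym (·ₚ-distribˡ c (f a) (sumFrom (suc a) l f)))

sumFrom-snoc : ∀ a l f → sumFrom a (suc l) f ≈ (sumFrom a l f +ₚ f (a + l))
sumFrom-snoc a zero    f = ≈-trans (+ₚ-identityʳ (f a)) (≈-reflexive (cong f (sym (ℕ.+-identityʳ a))))
sumFrom-snoc a (suc l) f = begin
  f a +ₚ sumFrom (suc a) (suc l) f            ≈⟨ +ₚ-congˡ (f a) (sumFrom-snoc (suc a) l f) ⟩
  f a +ₚ (sumFrom (suc a) l f +ₚ f (suc a + l)) ≈⟨ +ₚ-assoc (f a) (sumFrom (suc a) l f) (f (suc a + l)) ⟨
  (f a +ₚ sumFrom (suc a) l f) +ₚ f (suc a + l) ≡⟨ cong (λ i → (f a +ₚ sumFrom (suc a) l f) +ₚ f i) (sym (ℕ.+-suc a l)) ⟩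
  (f a +ₚ sumFrom (suc a) l f) +ₚ f (a + suc l) ∎
  where open ≈-Reasoning

[1+k]*[1+n]C[1+k]≡[1+n]*nCk : ∀ n k → suc k * (suc n C suc k) ≡ suc n * (n C k)
[1+k]*[1+n]C[1+k]≡[1+n]*nCk zero    zero    = refl
[1+k]*[1+n]C[1+k]≡[1+n]*nCk zero    (suc k) =
  trans (cong (suc (suc k) *_) (k>n⇒nCk≡0 {1} {suc (suc k)} (s≤s (s≤s z≤n)))) (ℕ.*-zeroʳ (suc (suc k)))
[1+k]*[1+n]C[1+k]≡[1+n]*nCk (suc n) zero    =
  trans (ℕ.*-identityˡ _) (trans (nC1≡n (suc (suc n))) (sym (ℕ.*-identityʳ (suc (suc n)))))
[1+k]*[1+n]C[1+k]≡[1+n]*nCk (suc n) (suc k) = begin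
  suc (suc k) * (suc (suc n) C suc (suc k))
    ≡⟨ cong (suc (suc k) *_) (nCk+nC[k+1]≡[n+1]C[k+1] (suc n) (suc k)) ⟨
  suc (suc k) * (A + B)
    ≡⟨ regroup k A B ⟩
  suc k * A + suc (suc k) * B + A
    ≡⟨ cong₂ (λ u v → u + v + A) ([1+k]*[1+n]C[1+k]≡[1+n]*nCk n k) ([1+k]*[1+n]C[1+k]≡[1+n]*nCk n (suc k)) ⟩
  suc n * (n C k) + suc n * (n C suc k) + A
    ≡⟨ cong (_+ A) (ℕ.*-distribˡ-+ (suc n) (n C k) (n C suc k)) ⟨
  suc n * (n C k + n C suc k) + A
    ≡⟨ cong (λ u → suc n * u + A) (nCk+nC[k+1]≡[n+1]C[k+1] n k) ⟩
  suc n * A + A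
    ≡⟨ ℕ.+-comm (suc n * A) A ⟩
  suc (suc n) * A ∎
  where
  open ≡-Reasoning
  A B : ℕ
  A = suc n C suc k
  B = suc n C suc (suc k)
  regroup : ∀ k a b → suc (suc k) * (a + b) ≡ suc k * a + suc (suc k) * b + a
  regroup = ℕ-Solver.solve-∀

[1+n]C[1+k]*[1+k]!≡[1+n]*nCk*k! : ∀ n k → (suc n C suc k) * (suc k) ! ≡ suc n * ((n C k) * k !)
[1+n]C[1+k]*[1+k]!≡[1+n]*nCk*k! n k = begin
  (suc n C suc k) * (suc k * k !)   ≡⟨ ℕ.*-assoc (suc n C suc k) (suc k) (k !) ⟨
  (suc n C suc k) * suc k * k !     ≡⟨ cong (_* k !) (ℕ.*-comm (suc n C suc k) (suc k)) ⟩
  suc k * (suc n C suc k) * k !     ≡⟨ cong (_* k !) ([1+k]*[1+n]C[1+k]≡[1+n]*nCk n k) ⟩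
  suc n * (n C k) * k !             ≡⟨ ℕ.*-assoc (suc n) (n C k) (k !) ⟩
  suc n * ((n C k) * k !)           ∎
  where open ≡-Reasoning

Der-term : ℕ → ℕ → Poly
Der-term n k = (+ ((n C k) * k !)) ·ₚ (X-1 ^ₚ (n ∸ k))

Der-term-suc : ∀ n k → Der-term (suc n) (suc k) ≈ ((+ suc n) ·ₚ Der-term n k)
Der-term-suc n k = begin
  (+ ((suc n C suc k) * (suc k) !)) ·ₚ (X-1 ^ₚ (n ∸ k))
    ≡⟨ cong (λ c → (+ c) ·ₚ (X-1 ^ₚ (n ∸ k))) ([1+n]C[1+k]*[1+k]!≡[1+n]*nCk*k! n k) ⟩
  (+ (suc n * ((n C k) * k !))) ·ₚ (X-1 ^ₚ (n ∸ k))
    ≡⟨ cong (_·ₚ (X-1 ^ₚ (n ∸ k))) (ℤ.pos-* (suc n) ((n C k) * k !)) ⟩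
  ((+ suc n) *ℤ (+ ((n C k) * k !))) ·ₚ (X-1 ^ₚ (n ∸ k))
    ≈⟨ ·ₚ-assoc (+ suc n) (+ ((n C k) * k !)) (X-1 ^ₚ (n ∸ k)) ⟨
  (+ suc n) ·ₚ Der-term n k ∎
  where open ≈-Reasoning

Der-suc : ∀ n → Der (suc n) ≈ (X-1 ^ₚ suc n +ₚ (+ suc n) ·ₚ Der n)
Der-suc n = +ₚ-cong (·ₚ-identityˡ (X-1 ^ₚ suc n)) (begin
  sumFrom 1 (suc n) (Der-term (suc n))                  ≡⟨ sumFrom-shift 0 (suc n) (Der-term (suc n)) ⟩
  sumFrom 0 (suc n) (λ k → Der-term (suc n) (suc k))    ≈⟨ sumFrom-cong 0 (suc n) (Der-term-suc n) ⟩
  sumFrom 0 (suc n) (λ k → (+ suc n) ·ₚ Der-term n k)   ≈⟨ sumFrom-·ₚ 0 (suc n) (+ suc n) (Der-term n) ⟩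
  (+ suc n) ·ₚ Der n                                    ∎)
  where open ≈-Reasoning

Der-expansion : ∀ k →
  Der (3 + k) ≈ (sumFrom 1 k (λ i → (+ (3 + k ∸ i)) ·ₚ Der (3 + k ∸ i)) +ₚ (+ 3) ·ₚ Der 2)
                +ₚ sumFrom 3 (suc k) (X-1 ^ₚ_)
Der-expansion zero    = ≈-trans (Der-suc 2) (+ₚ-comm (X-1 ^ₚ 3) ((+ 3) ·ₚ Der 2))
Der-expansion (suc k) = begin
  Der (suc n)
    ≈⟨ Der-suc n ⟩
  X-1 ^ₚ suc n +ₚ (1ℤ +ℤ + n) ·ₚ D
    ≈⟨ +ₚ-congˡ (X-1 ^ₚ suc n) (·ₚ-distribʳ 1ℤ (+ n) D) ⟩
  X-1 ^ₚ suc n +ₚ (1ℤ ·ₚ D +ₚ (+ n) ·ₚ D)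
    ≈⟨ +ₚ-congˡ (X-1 ^ₚ suc n) (+ₚ-cong (≈-trans (·ₚ-identityˡ D) (Der-expansion k)) ≈-refl) ⟩
  X-1 ^ₚ suc n +ₚ (((F +ₚ E) +ₚ G) +ₚ (+ n) ·ₚ D)
    ≈⟨ regroup (X-1 ^ₚ suc n) F E G ((+ n) ·ₚ D) ⟩
  (((+ n) ·ₚ D +ₚ F) +ₚ E) +ₚ (G +ₚ X-1 ^ₚ suc n)
    ≈⟨ +ₚ-cong (≈-reflexive (cong (λ F′ → ((+ n) ·ₚ D +ₚ F′) +ₚ E) (sumFrom-shift 1 k _)))
               (sumFrom-snoc 3 (suc k) (X-1 ^ₚ_)) ⟨
  (sumFrom 1 (suc k) (λ i → (+ (suc n ∸ i)) ·ₚ Der (suc n ∸ i)) +ₚ E) +ₚ sumFrom 3 (suc (suc k)) (X-1 ^ₚ_)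
    ∎
  where
  open ≈-Reasoning
  n : ℕ
  n = 3 + k
  D E F G : Poly
  D = Der n
  E = (+ 3) ·ₚ Der 2
  F = sumFrom 1 k (λ i → (+ (n ∸ i)) ·ₚ Der (n ∸ i))
  G = sumFrom 3 (suc k) (X-1 ^ₚ_)
  regroup : ∀ y f e g d → (y +ₚ (((f +ₚ e) +ₚ g) +ₚ d)) ≈ (((d +ₚ f) +ₚ e) +ₚ (g +ₚ y))
  regroup y f e g d =
    prove 5 (y′ ⊕ (((f′ ⊕ e′) ⊕ g′) ⊕ d′)) (((d′ ⊕ f′) ⊕ e′) ⊕ (g′ ⊕ y′))
            (y Vec.∷ f Vec.∷ e Vec.∷ g Vec.∷ d Vec.∷ Vec.[])
    where
    open CommMonoidSolver +ₚ-commutativeMonoid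
    y′ f′ e′ g′ d′ : Expr 5
    y′ = var #0
    f′ = var (#suc #0)
    e′ = var (#suc (#suc #0))
    g′ = var (#suc (#suc (#suc #0)))
    d′ = var (#suc (#suc (#suc (#suc #0))))

∣ₛ-0 : ∀ {d} → d ∣ₛ 0ℤ
∣ₛ-0 = Signed.divides 0ℤ refl

∣ₛ-resp-≡ : ∀ {d a b} → a ≡ b → d ∣ₛ a → d ∣ₛ b
∣ₛ-resp-≡ {d} = subst (d ∣ₛ_)

≡⇒∣ₛ-diff : ∀ {d a b} → a ≡ b → d ∣ₛ a -ℤ b
≡⇒∣ₛ-diff {a = a} refl = ∣ₛ-resp-≡ (sym (ℤ.+-inverseʳ a)) ∣ₛ-0

infix 4 _≈_[mod_]
record _≈_[mod_] (P Q : Poly) (d : ℤ) : Set where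
  constructor coeffwise-mod
  field coeff-∣ : ∀ k → d ∣ₛ coeff P k -ℤ coeff Q k
open _≈_[mod_] public

module _ {d : ℤ} where

  ≈⇒≈[mod] : ∀ {P Q} → P ≈ Q → P ≈ Q [mod d ]
  ≈⇒≈[mod] P≈Q = coeffwise-mod λ k → ≡⇒∣ₛ-diff (coeff-≡ P≈Q k)

  ≈[mod]-isEquivalence : IsEquivalence (_≈_[mod d ])
  ≈[mod]-isEquivalence = record
    { refl  = ≈⇒≈[mod] ≈-refl
    ; sym   = λ {P} {Q} P≈Q → coeffwise-mod λ k →
        ∣ₛ-resp-≡ (negate (coeff P k) (coeff Q k)) (Signed.∣n⇒∣m*n -1ℤ (coeff-∣ P≈Q k))
    ; trans = λ {P} {Q} {R} P≈Q Q≈R → coeffwise-mod λ k →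
        ∣ₛ-resp-≡ (telescope (coeff P k) (coeff Q k) (coeff R k))
                  (Signed.∣m∣n⇒∣m+n (coeff-∣ P≈Q k) (coeff-∣ Q≈R k))
    }
    where
    negate : ∀ a b → -1ℤ *ℤ (a -ℤ b) ≡ b -ℤ a
    negate = solve-∀
    telescope : ∀ a b c → (a -ℤ b) +ℤ (b -ℤ c) ≡ a -ℤ c
    telescope = solve-∀

  ≈[mod]-setoid : Setoid 0ℓ 0ℓ
  ≈[mod]-setoid = record { isEquivalence = ≈[mod]-isEquivalence }

  open IsEquivalence ≈[mod]-isEquivalence public
    using () renaming (refl to ≈[mod]-refl; sym to ≈[mod]-sym; trans to ≈[mod]-trans)

  module ≈[mod]-Reasoning = SetoidReasoning ≈[mod]-setoid

  +ₚ-cong-mod : ∀ {P P′ Q Q′} → P ≈ P′ [mod d ] → Q ≈ Q′ [mod d ] → (P +ₚ Q) ≈ (P′ +ₚ Q′) [mod d ]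
  +ₚ-cong-mod {P} {P′} {Q} {Q′} P≈P′ Q≈Q′ = coeffwise-mod λ k →
    ∣ₛ-resp-≡ (trans (interchange-diff (coeff P k) (coeff P′ k) (coeff Q k) (coeff Q′ k))
                     (sym (cong₂ _-ℤ_ (coeff-+ P Q k) (coeff-+ P′ Q′ k))))
              (Signed.∣m∣n⇒∣m+n (coeff-∣ P≈P′ k) (coeff-∣ Q≈Q′ k))
    where
    interchange-diff : ∀ a a′ b b′ → (a -ℤ a′) +ℤ (b -ℤ b′) ≡ (a +ℤ b) -ℤ (a′ +ℤ b′)
    interchange-diff = solve-∀

  ∷-cong-mod : ∀ a {P Q} → P ≈ Q [mod d ] → (a ∷ P) ≈ (a ∷ Q) [mod d ]
  ∷-cong-mod a P≈Q = coeffwise-mod λ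
    { zero    → ≡⇒∣ₛ-diff {a = a} refl
    ; (suc k) → coeff-∣ P≈Q k
    }

  ·ₚ-congʳ-mod : ∀ c {P Q} → P ≈ Q [mod d ] → (c ·ₚ P) ≈ (c ·ₚ Q) [mod d ]
  ·ₚ-congʳ-mod c {P} {Q} P≈Q = coeffwise-mod λ k →
    ∣ₛ-resp-≡ (trans (distrib c (coeff P k) (coeff Q k)) (sym (cong₂ _-ℤ_ (coeff-· c P k) (coeff-· c Q k))))
              (Signed.∣n⇒∣m*n c (coeff-∣ P≈Q k))
    where
    distrib : ∀ c a b → c *ℤ (a -ℤ b) ≡ c *ℤ a -ℤ c *ℤ b
    distrib = solve-∀

  ·ₚ-congˡ-mod : ∀ {a b} P → d ∣ₛ a -ℤ b → (a ·ₚ P) ≈ (b ·ₚ P) [mod d ]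
  ·ₚ-congˡ-mod {a} {b} P d∣a-b = coeffwise-mod λ k →
    ∣ₛ-resp-≡ (trans (distrib a b (coeff P k)) (sym (cong₂ _-ℤ_ (coeff-· a P k) (coeff-· b P k))))
              (Signed.∣m⇒∣m*n (coeff P k) d∣a-b)
    where
    distrib : ∀ a b x → (a -ℤ b) *ℤ x ≡ a *ℤ x -ℤ b *ℤ x
    distrib = solve-∀

  *ₚ-congˡ-mod : ∀ A {P Q} → P ≈ Q [mod d ] → (A *ₚ P) ≈ (A *ₚ Q) [mod d ]
  *ₚ-congˡ-mod []      P≈Q = ≈[mod]-refl
  *ₚ-congˡ-mod (a ∷ A) P≈Q = +ₚ-cong-mod (·ₚ-congʳ-mod a P≈Q) (∷-cong-mod 0ℤ (*ₚ-congˡ-mod A P≈Q))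

  *ₚ-zeroˡ-mod : ∀ {R} S → R ≈ [] [mod d ] → (R *ₚ S) ≈ [] [mod d ]
  *ₚ-zeroˡ-mod {[]}    S R≈0 = ≈[mod]-refl
  *ₚ-zeroˡ-mod {r ∷ R} S R≈0 = begin
    r ·ₚ S +ₚ (0ℤ ∷ (R *ₚ S))  ≈⟨ +ₚ-cong-mod (·ₚ-congˡ-mod S (coeff-∣ R≈0 0))
                                             (∷-cong-mod 0ℤ (*ₚ-zeroˡ-mod {R} S (coeffwise-mod λ k → coeff-∣ R≈0 (suc k)))) ⟩
    0ℤ ·ₚ S +ₚ (0ℤ ∷ [])       ≈⟨ ≈⇒≈[mod] (+ₚ-cong (·ₚ-zeroˡ S) [0]≈[]) ⟩
    []                         ∎
    where open ≈[mod]-Reasoning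

  ≈[mod]⇒-ₚ≈[] : ∀ {P Q} → P ≈ Q [mod d ] → (P -ₚ Q) ≈ [] [mod d ]
  ≈[mod]⇒-ₚ≈[] {P} {Q} P≈Q = coeffwise-mod λ k →
    ∣ₛ-resp-≡ (trans (sym (coeff-- P Q k)) (sym (ℤ.+-identityʳ (coeff (P -ₚ Q) k)))) (coeff-∣ P≈Q k)

  -ₚ≈[]⇒≈[mod] : ∀ {P Q} → (P -ₚ Q) ≈ [] [mod d ] → P ≈ Q [mod d ]
  -ₚ≈[]⇒≈[mod] {P} {Q} P-Q≈0 = coeffwise-mod λ k →
    ∣ₛ-resp-≡ (trans (ℤ.+-identityʳ (coeff (P -ₚ Q) k)) (coeff-- P Q k)) (coeff-∣ P-Q≈0 k)

  *ₚ-congʳ-mod : ∀ {P Q} S → P ≈ Q [mod d ] → (P *ₚ S) ≈ (Q *ₚ S) [mod d ]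
  *ₚ-congʳ-mod {P} {Q} S P≈Q = -ₚ≈[]⇒≈[mod] (begin
    P *ₚ S -ₚ Q *ₚ S                ≈⟨ ≈⇒≈[mod] (+ₚ-congˡ (P *ₚ S) (·ₚ-*ₚ-assoc -1ℤ Q S)) ⟨
    P *ₚ S +ₚ (negₚ Q) *ₚ S         ≈⟨ ≈⇒≈[mod] (*ₚ-distribʳ P (negₚ Q) S) ⟨
    (P -ₚ Q) *ₚ S                   ≈⟨ *ₚ-zeroˡ-mod S (≈[mod]⇒-ₚ≈[] P≈Q) ⟩
    []                              ∎)
    where open ≈[mod]-Reasoning

  ^ₚ-cong-mod : ∀ {P Q} m → P ≈ Q [mod d ] → (P ^ₚ m) ≈ (Q ^ₚ m) [mod d ]
  ^ₚ-cong-mod zero          P≈Q = ≈[mod]-refl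
  ^ₚ-cong-mod {P} {Q} (suc m) P≈Q =
    ≈[mod]-trans (*ₚ-congʳ-mod (P ^ₚ m) P≈Q) (*ₚ-congˡ-mod Q (^ₚ-cong-mod m P≈Q))

Der≈X-1^-mod : ∀ {d} M → d ∣ₛ + M → Der M ≈ X-1 ^ₚ M [mod d ]
Der≈X-1^-mod zero    d∣M = ≈[mod]-refl
Der≈X-1^-mod {d} (suc M) d∣M = begin
  Der (suc M)                          ≈⟨ ≈⇒≈[mod] (Der-suc M) ⟩
  X-1 ^ₚ suc M +ₚ (+ suc M) ·ₚ Der M   ≈⟨ +ₚ-cong-mod ≈[mod]-refl (·ₚ-congˡ-mod (Der M) d∣M-0) ⟩
  X-1 ^ₚ suc M +ₚ 0ℤ ·ₚ Der M          ≈⟨ ≈⇒≈[mod] (+ₚ-cong (≈-refl {X-1 ^ₚ suc M}) (·ₚ-zeroˡ (Der M))) ⟩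
  X-1 ^ₚ suc M +ₚ []                   ≈⟨ ≈⇒≈[mod] (+ₚ-identityʳ (X-1 ^ₚ suc M)) ⟩
  X-1 ^ₚ suc M                         ∎
  where
  open ≈[mod]-Reasoning
  d∣M-0 : d ∣ₛ + suc M -ℤ 0ℤ
  d∣M-0 = ∣ₛ-resp-≡ (sym (ℤ.+-identityʳ (+ suc M))) d∣M

Der-+-mod : ∀ {d M} → d ∣ₛ + M → ∀ n → Der (n + M) ≈ X-1 ^ₚ M *ₚ Der n [mod d ]
Der-+-mod {M = M} d∣M zero    =
  ≈[mod]-trans (Der≈X-1^-mod M d∣M) (≈⇒≈[mod] (≈-sym (*ₚ-identityʳ (X-1 ^ₚ M))))
Der-+-mod {d} {M} d∣M (suc n) = begin
  Der (suc (n + M))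
    ≈⟨ ≈⇒≈[mod] (Der-suc (n + M)) ⟩
  X-1 ^ₚ suc (n + M) +ₚ (+ suc (n + M)) ·ₚ Der (n + M)
    ≈⟨ +ₚ-cong-mod ≈[mod]-refl (·ₚ-congˡ-mod (Der (n + M)) d∣[1+n+M]-[1+n]) ⟩
  X-1 ^ₚ suc (n + M) +ₚ (+ suc n) ·ₚ Der (n + M)
    ≈⟨ +ₚ-cong-mod ≈[mod]-refl (·ₚ-congʳ-mod (+ suc n) (Der-+-mod d∣M n)) ⟩
  X-1 ^ₚ suc (n + M) +ₚ (+ suc n) ·ₚ (X-1 ^ₚ M *ₚ Der n)
    ≈⟨ ≈⇒≈[mod] (+ₚ-cong power-split (≈-sym (*ₚ-·ₚ-comm (X-1 ^ₚ M) (+ suc n) (Der n)))) ⟩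
  X-1 ^ₚ M *ₚ X-1 ^ₚ suc n +ₚ X-1 ^ₚ M *ₚ ((+ suc n) ·ₚ Der n)
    ≈⟨ ≈⇒≈[mod] (*ₚ-distribˡ (X-1 ^ₚ M) (X-1 ^ₚ suc n) ((+ suc n) ·ₚ Der n)) ⟨
  X-1 ^ₚ M *ₚ (X-1 ^ₚ suc n +ₚ (+ suc n) ·ₚ Der n)
    ≈⟨ ≈⇒≈[mod] (*ₚ-congˡ (X-1 ^ₚ M) (Der-suc n)) ⟨
  X-1 ^ₚ M *ₚ Der (suc n)
    ∎
  where
  open ≈[mod]-Reasoning
  d∣[1+n+M]-[1+n] : d ∣ₛ + suc (n + M) -ℤ + suc n
  d∣[1+n+M]-[1+n] = ∣ₛ-resp-≡ (sym (trans (cong (_-ℤ + suc n) (ℤ.pos-+ (suc n) M)) (cancel (+ suc n) (+ M)))) d∣M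
    where
    cancel : ∀ a b → (a +ℤ b) -ℤ a ≡ b
    cancel = solve-∀
  power-split : X-1 ^ₚ suc (n + M) ≈ X-1 ^ₚ M *ₚ X-1 ^ₚ suc n
  power-split = ≈-trans (≈-reflexive (cong (X-1 ^ₚ_) (trans (cong suc (ℕ.+-comm n M)) (sym (ℕ.+-suc M n)))))
                        (^ₚ-distribˡ-+-*ₚ X-1 M (suc n))

Der-+-*-mod : ∀ {d M} → d ∣ₛ + M → ∀ m n → Der (n + m * M) ≈ (X-1 ^ₚ M) ^ₚ m *ₚ Der n [mod d ]
Der-+-*-mod {M = M} d∣M zero    n =
  ≈⇒≈[mod] (≈-trans (≈-reflexive (cong Der (ℕ.+-identityʳ n))) (≈-sym (*ₚ-identityˡ (Der n))))
Der-+-*-mod {M = M} d∣M (suc m) n = begin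
  Der (n + (M + m * M))                    ≡⟨ cong Der (reassoc n M (m * M)) ⟩
  Der ((n + m * M) + M)                    ≈⟨ Der-+-mod d∣M (n + m * M) ⟩
  X-1 ^ₚ M *ₚ Der (n + m * M)              ≈⟨ *ₚ-congˡ-mod (X-1 ^ₚ M) (Der-+-*-mod d∣M m n) ⟩
  X-1 ^ₚ M *ₚ ((X-1 ^ₚ M) ^ₚ m *ₚ Der n)   ≈⟨ ≈⇒≈[mod] (*ₚ-assoc (X-1 ^ₚ M) ((X-1 ^ₚ M) ^ₚ m) (Der n)) ⟨
  (X-1 ^ₚ M) ^ₚ suc m *ₚ Der n             ∎
  where
  open ≈[mod]-Reasoning
  reassoc : ∀ a b c → a + (b + c) ≡ (a + c) + b
  reassoc = ℕ-Solver.solve-∀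

X*ₚ : ∀ Q → (X *ₚ Q) ≈ (0ℤ ∷ Q)
X*ₚ Q = +ₚ-cong (·ₚ-zeroˡ Q) (∷-cong 0ℤ (*ₚ-identityˡ Q))

X-1*ₚ : ∀ Q → (X-1 *ₚ Q) ≈ ((0ℤ ∷ Q) -ₚ Q)
X-1*ₚ Q = begin
  (X +ₚ negₚ (constₚ 1ℤ)) *ₚ Q             ≈⟨ *ₚ-distribʳ X (negₚ (constₚ 1ℤ)) Q ⟩
  X *ₚ Q +ₚ negₚ (constₚ 1ℤ) *ₚ Q          ≈⟨ +ₚ-cong (X*ₚ Q) (·ₚ-*ₚ-assoc -1ℤ (constₚ 1ℤ) Q) ⟩
  (0ℤ ∷ Q) +ₚ negₚ (constₚ 1ℤ *ₚ Q)        ≈⟨ +ₚ-congˡ (0ℤ ∷ Q) (·ₚ-congʳ -1ℤ (*ₚ-identityˡ Q)) ⟩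
  (0ℤ ∷ Q) -ₚ Q                            ∎
  where open ≈-Reasoning

coeff-X^ₚ-≡ : ∀ N → coeff (X ^ₚ N) N ≡ 1ℤ
coeff-X^ₚ-≡ zero    = refl
coeff-X^ₚ-≡ (suc N) = trans (coeff-≡ (X*ₚ (X ^ₚ N)) (suc N)) (coeff-X^ₚ-≡ N)

coeff-X^ₚ-≢ : ∀ N k → k ≢ N → coeff (X ^ₚ N) k ≡ 0ℤ
coeff-X^ₚ-≢ zero    zero    k≢N = ⊥-elim (k≢N refl)
coeff-X^ₚ-≢ zero    (suc k) k≢N = refl
coeff-X^ₚ-≢ (suc N) zero    k≢N = coeff-≡ (X*ₚ (X ^ₚ N)) zero
coeff-X^ₚ-≢ (suc N) (suc k) k≢N =
  trans (coeff-≡ (X*ₚ (X ^ₚ N)) (suc k)) (coeff-X^ₚ-≢ N k (λ k≡N → k≢N (cong suc k≡N)))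

coeff-X-1^ₚ : ∀ N k → coeff (X-1 ^ₚ N) k ≡ -1ℤ ^ℤ (N + k) *ℤ + (N C k)
coeff-X-1^ₚ zero    zero    = refl
coeff-X-1^ₚ zero    (suc k) = sym (ℤ.*-zeroʳ (-1ℤ ^ℤ suc k))
coeff-X-1^ₚ (suc N) zero    = begin
  coeff (X-1 *ₚ X-1 ^ₚ N) 0                     ≡⟨ coeff-≡ (X-1*ₚ (X-1 ^ₚ N)) 0 ⟩
  coeff ((0ℤ ∷ X-1 ^ₚ N) -ₚ X-1 ^ₚ N) 0         ≡⟨ coeff-- (0ℤ ∷ X-1 ^ₚ N) (X-1 ^ₚ N) 0 ⟩
  0ℤ -ℤ coeff (X-1 ^ₚ N) 0                      ≡⟨ cong (0ℤ -ℤ_) (coeff-X-1^ₚ N 0) ⟩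
  0ℤ -ℤ -1ℤ ^ℤ (N + 0) *ℤ 1ℤ                     ≡⟨ negate (-1ℤ ^ℤ (N + 0)) ⟩
  (-1ℤ *ℤ -1ℤ ^ℤ (N + 0)) *ℤ 1ℤ                  ∎
  where
  open ≡-Reasoning
  negate : ∀ s → 0ℤ -ℤ s *ℤ 1ℤ ≡ (-1ℤ *ℤ s) *ℤ 1ℤ
  negate = solve-∀
coeff-X-1^ₚ (suc N) (suc k) = begin
  coeff (X-1 *ₚ X-1 ^ₚ N) (suc k)                  ≡⟨ coeff-≡ (X-1*ₚ (X-1 ^ₚ N)) (suc k) ⟩
  coeff ((0ℤ ∷ X-1 ^ₚ N) -ₚ X-1 ^ₚ N) (suc k)      ≡⟨ coeff-- (0ℤ ∷ X-1 ^ₚ N) (X-1 ^ₚ N) (suc k) ⟩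
  coeff (X-1 ^ₚ N) k -ℤ coeff (X-1 ^ₚ N) (suc k)   ≡⟨ cong₂ _-ℤ_ (coeff-X-1^ₚ N k) (coeff-X-1^ₚ N (suc k)) ⟩
  s *ℤ + (N C k) -ℤ -1ℤ ^ℤ (N + suc k) *ℤ + (N C suc k)
    ≡⟨ cong (λ i → s *ℤ + (N C k) -ℤ -1ℤ ^ℤ i *ℤ + (N C suc k)) (ℕ.+-suc N k) ⟩
  s *ℤ + (N C k) -ℤ (-1ℤ *ℤ s) *ℤ + (N C suc k)
    ≡⟨ pascal s (+ (N C k)) (+ (N C suc k)) ⟩
  (-1ℤ *ℤ (-1ℤ *ℤ s)) *ℤ (+ (N C k) +ℤ + (N C suc k))
    ≡⟨ cong₂ (λ i c → (-1ℤ *ℤ -1ℤ ^ℤ i) *ℤ c) (sym (ℕ.+-suc N k))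
             (trans (sym (ℤ.pos-+ (N C k) (N C suc k))) (cong +_ (nCk+nC[k+1]≡[n+1]C[k+1] N k))) ⟩
  -1ℤ ^ℤ (suc N + suc k) *ℤ + (suc N C suc k)       ∎
  where
  open ≡-Reasoning
  s = -1ℤ ^ℤ (N + k)
  pascal : ∀ s a b → s *ℤ a -ℤ (-1ℤ *ℤ s) *ℤ b ≡ (-1ℤ *ℤ (-1ℤ *ℤ s)) *ℤ (a +ℤ b)
  pascal = solve-∀

odd⇒-1^n≡-1 : ∀ n → ¬ 2 ∣ℕ n → -1ℤ ^ℤ n ≡ -1ℤ
odd⇒-1^n≡-1 zero          2∤n = ⊥-elim (2∤n (2 ℕ∣.∣0))
odd⇒-1^n≡-1 (suc zero)    2∤n = refl
odd⇒-1^n≡-1 (suc (suc n)) 2∤n =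
  cong (λ x → -1ℤ *ℤ (-1ℤ *ℤ x)) (odd⇒-1^n≡-1 n (2∤n ∘ ℕ∣.∣m∣n⇒∣m+n (ℕ∣.∣-refl {2})))

odd⇒odd^ : ∀ {m} → ¬ 2 ∣ℕ m → ∀ n → ¬ 2 ∣ℕ m ^ n
odd⇒odd^ 2∤m zero    2∣1 with ℕ∣.∣1⇒≡1 2∣1
... | ()
odd⇒odd^ {m} 2∤m (suc n) 2∣m^[1+n] with euclidsLemma m (m ^ n) prime[2] 2∣m^[1+n]
... | inj₁ 2∣m   = 2∤m 2∣m
... | inj₂ 2∣m^n = odd⇒odd^ 2∤m n 2∣m^n

prime≥3⇒odd : ∀ {p} → Prime p → 3 ≤ p → ¬ 2 ∣ℕ p
prime≥3⇒odd p-prime 3≤p 2∣p = Prime.notComposite p-prime (composite 3≤p 2∣p)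

p^s∣j*c⇒p∣c : ∀ {p} → Prime p → ∀ s {j c} → 0 < j → j < p ^ s → p ^ s ∣ℕ j * c → p ∣ℕ c
p^s∣j*c⇒p∣c p-prime zero    0<j (s≤s j≤0) _ = ⊥-elim (ℕ.<-irrefl refl (ℕ.<-≤-trans 0<j j≤0))
p^s∣j*c⇒p∣c {p} p-prime (suc s) {j} {c} 0<j j<p^[1+s] p^[1+s]∣jc with p ℕ∣.∣? j
... | no p∤j with euclidsLemma j c p-prime (ℕ∣.∣-trans (ℕ∣.m∣m*n (p ^ s)) p^[1+s]∣jc)
...   | inj₁ p∣j = ⊥-elim (p∤j p∣j)
...   | inj₂ p∣c = p∣c
p^s∣j*c⇒p∣c {p} p-prime (suc s) {c = c} 0<j j<p^[1+s] p^[1+s]∣jc | yes (ℕ∣.divides q refl) =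
  p^s∣j*c⇒p∣c p-prime s 0<q (ℕ.*-cancelˡ-< p q (p ^ s) (subst (_< p * p ^ s) (ℕ.*-comm q p) j<p^[1+s]))
    (ℕ∣.*-cancelˡ-∣ p (subst (p * p ^ s ∣ℕ_) (reassoc q p c) p^[1+s]∣jc))
  where
  instance
    p≢0 : NonZero p
    p≢0 = prime⇒nonZero p-prime
  reassoc : ∀ q p c → q * p * c ≡ p * (q * c)
  reassoc = ℕ-Solver.solve-∀
  0<q : 0 < q
  0<q = ℕ.n≢0⇒n>0 λ { refl → ℕ.<-irrefl refl 0<j }

n∣[1+k]*nC[1+k] : ∀ n k → n ∣ℕ suc k * (n C suc k)
n∣[1+k]*nC[1+k] zero    k = subst (0 ∣ℕ_) (sym (ℕ.*-zeroʳ (suc k))) (0 ℕ∣.∣0)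
n∣[1+k]*nC[1+k] (suc n) k =
  ℕ∣.divides (n C k) (trans ([1+k]*[1+n]C[1+k]≡[1+n]*nCk n k) (ℕ.*-comm (suc n) (n C k)))

p∣[p^s]Ck : ∀ {p} → Prime p → ∀ s k → 0 < k → k < p ^ s → p ∣ℕ (p ^ s) C k
p∣[p^s]Ck {p} p-prime s (suc k) 0<k k<p^s =
  p^s∣j*c⇒p∣c p-prime s 0<k k<p^s (n∣[1+k]*nC[1+k] (p ^ s) k)

frobenius : ∀ {d} N → ¬ 2 ∣ℕ N → (∀ k → 0 < k → k < N → d ∣ₛ + (N C k)) →
            X-1 ^ₚ N ≈ X ^ₚ N -ₚ constₚ 1ℤ [mod d ]
frobenius {d} N 2∤N d∣NCk = coeffwise-mod λ k →
  ∣ₛ-resp-≡ (cong (coeff (X-1 ^ₚ N) k -ℤ_) (sym (coeff-- (X ^ₚ N) (constₚ 1ℤ) k))) (coefficient k)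
  where
  -1^N≡-1 : -1ℤ ^ℤ N ≡ -1ℤ
  -1^N≡-1 = odd⇒-1^n≡-1 N 2∤N
  0≢N : 0 ≢ N
  0≢N refl = 2∤N (2 ℕ∣.∣0)
  coefficient : ∀ k → d ∣ₛ coeff (X-1 ^ₚ N) k -ℤ (coeff (X ^ₚ N) k -ℤ coeff (constₚ 1ℤ) k)
  coefficient zero = ≡⇒∣ₛ-diff (begin
    coeff (X-1 ^ₚ N) 0              ≡⟨ coeff-X-1^ₚ N 0 ⟩
    -1ℤ ^ℤ (N + 0) *ℤ 1ℤ            ≡⟨ cong (λ i → -1ℤ ^ℤ i *ℤ 1ℤ) (ℕ.+-identityʳ N) ⟩
    -1ℤ ^ℤ N *ℤ 1ℤ                  ≡⟨ cong (_*ℤ 1ℤ) -1^N≡-1 ⟩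
    -1ℤ                             ≡⟨ cong (_-ℤ 1ℤ) (coeff-X^ₚ-≢ N 0 0≢N) ⟨
    coeff (X ^ₚ N) 0 -ℤ 1ℤ          ∎)
    where open ≡-Reasoning
  coefficient (suc k) with ℕ.<-cmp (suc k) N
  ... | tri< k<N k≢N _ = ∣ₛ-resp-≡ (cong₂ _-ℤ_ (sym (coeff-X-1^ₚ N (suc k)))
                                            (sym (cong (_-ℤ 0ℤ) (coeff-X^ₚ-≢ N (suc k) k≢N))))
    (∣ₛ-resp-≡ (sym (ℤ.+-identityʳ _)) (Signed.∣n⇒∣m*n (-1ℤ ^ℤ (N + suc k)) (d∣NCk (suc k) (s≤s z≤n) k<N)))
  ... | tri≈ _ refl _ = ≡⇒∣ₛ-diff (begin
    coeff (X-1 ^ₚ N) N                   ≡⟨ coeff-X-1^ₚ N N ⟩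
    -1ℤ ^ℤ (N + N) *ℤ + (N C N)          ≡⟨ cong₂ _*ℤ_ (ℤ.^-distribˡ-+-* -1ℤ N N) (cong +_ (nCn≡1 N)) ⟩
    -1ℤ ^ℤ N *ℤ -1ℤ ^ℤ N *ℤ 1ℤ           ≡⟨ cong (λ x → x *ℤ x *ℤ 1ℤ) -1^N≡-1 ⟩
    1ℤ                                   ≡⟨ cong (_-ℤ 0ℤ) (coeff-X^ₚ-≡ N) ⟨
    coeff (X ^ₚ N) N -ℤ 0ℤ               ∎)
    where open ≡-Reasoning
  ... | tri> _ k≢N N<k = ≡⇒∣ₛ-diff (begin
    coeff (X-1 ^ₚ N) (suc k)                   ≡⟨ coeff-X-1^ₚ N (suc k) ⟩
    -1ℤ ^ℤ (N + suc k) *ℤ + (N C suc k)        ≡⟨ cong (λ c → -1ℤ ^ℤ (N + suc k) *ℤ + c) (k>n⇒nCk≡0 N<k) ⟩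
    -1ℤ ^ℤ (N + suc k) *ℤ 0ℤ                   ≡⟨ ℤ.*-zeroʳ (-1ℤ ^ℤ (N + suc k)) ⟩
    0ℤ                                         ≡⟨ cong (_-ℤ 0ℤ) (coeff-X^ₚ-≢ N (suc k) k≢N) ⟨
    coeff (X ^ₚ N) (suc k) -ℤ 0ℤ               ∎)
    where open ≡-Reasoning

frobenius-prime-power : ∀ {p} → Prime p → 3 ≤ p → ∀ s →
                        X-1 ^ₚ (p ^ s) ≈ X ^ₚ (p ^ s) -ₚ constₚ 1ℤ [mod + p ]
frobenius-prime-power p-prime 3≤p s =
  frobenius _ (odd⇒odd^ (prime≥3⇒odd p-prime 3≤p) s)
    (λ k 0<k k<p^s → Signed.∣ᵤ⇒∣ (p∣[p^s]Ck p-prime s k 0<k k<p^s))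

eval-+ₚ : ∀ P Q x → eval (P +ₚ Q) x ≡ eval P x +ℤ eval Q x
eval-+ₚ []      Q       x = sym (ℤ.+-identityˡ (eval Q x))
eval-+ₚ (a ∷ P) []      x = sym (ℤ.+-identityʳ (eval (a ∷ P) x))
eval-+ₚ (a ∷ P) (b ∷ Q) x = begin
  (a +ℤ b) +ℤ x *ℤ eval (P +ₚ Q) x             ≡⟨ cong (λ e → (a +ℤ b) +ℤ x *ℤ e) (eval-+ₚ P Q x) ⟩
  (a +ℤ b) +ℤ x *ℤ (eval P x +ℤ eval Q x)      ≡⟨ regroup a b x (eval P x) (eval Q x) ⟩
  (a +ℤ x *ℤ eval P x) +ℤ (b +ℤ x *ℤ eval Q x) ∎
  where
  open ≡-Reasoning
  regroup : ∀ a b x u v → (a +ℤ b) +ℤ x *ℤ (u +ℤ v) ≡ (a +ℤ x *ℤ u) +ℤ (b +ℤ x *ℤ v)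
  regroup = solve-∀

eval-·ₚ : ∀ c P x → eval (c ·ₚ P) x ≡ c *ℤ eval P x
eval-·ₚ c []      x = sym (ℤ.*-zeroʳ c)
eval-·ₚ c (a ∷ P) x = begin
  c *ℤ a +ℤ x *ℤ eval (c ·ₚ P) x   ≡⟨ cong (λ e → c *ℤ a +ℤ x *ℤ e) (eval-·ₚ c P x) ⟩
  c *ℤ a +ℤ x *ℤ (c *ℤ eval P x)   ≡⟨ factor c a x (eval P x) ⟩
  c *ℤ (a +ℤ x *ℤ eval P x)        ∎
  where
  open ≡-Reasoning
  factor : ∀ c a x u → c *ℤ a +ℤ x *ℤ (c *ℤ u) ≡ c *ℤ (a +ℤ x *ℤ u)
  factor = solve-∀

eval--ₚ : ∀ P Q x → eval (P -ₚ Q) x ≡ eval P x -ℤ eval Q x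
eval--ₚ P Q x = begin
  eval (P +ₚ negₚ Q) x             ≡⟨ eval-+ₚ P (negₚ Q) x ⟩
  eval P x +ℤ eval (negₚ Q) x      ≡⟨ cong (eval P x +ℤ_) (eval-·ₚ -1ℤ Q x) ⟩
  eval P x +ℤ -1ℤ *ℤ eval Q x      ≡⟨ cong (eval P x +ℤ_) (ℤ.-1*i≡-i (eval Q x)) ⟩
  eval P x -ℤ eval Q x             ∎
  where open ≡-Reasoning

eval-*ₚ : ∀ P Q x → eval (P *ₚ Q) x ≡ eval P x *ℤ eval Q x
eval-*ₚ []      Q x = refl
eval-*ₚ (a ∷ P) Q x = begin
  eval (a ·ₚ Q +ₚ (0ℤ ∷ (P *ₚ Q))) x                  ≡⟨ eval-+ₚ (a ·ₚ Q) (0ℤ ∷ (P *ₚ Q)) x ⟩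
  eval (a ·ₚ Q) x +ℤ (0ℤ +ℤ x *ℤ eval (P *ₚ Q) x)     ≡⟨ cong₂ (λ u v → u +ℤ (0ℤ +ℤ x *ℤ v)) (eval-·ₚ a Q x) (eval-*ₚ P Q x) ⟩
  a *ℤ eval Q x +ℤ (0ℤ +ℤ x *ℤ (eval P x *ℤ eval Q x)) ≡⟨ factor a x (eval P x) (eval Q x) ⟩
  (a +ℤ x *ℤ eval P x) *ℤ eval Q x                     ∎
  where
  open ≡-Reasoning
  factor : ∀ a x u v → a *ℤ v +ℤ (0ℤ +ℤ x *ℤ (u *ℤ v)) ≡ (a +ℤ x *ℤ u) *ℤ v
  factor = solve-∀

eval-constₚ : ∀ c x → eval (constₚ c) x ≡ c
eval-constₚ c x = trans (cong (c +ℤ_) (ℤ.*-zeroʳ x)) (ℤ.+-identityʳ c)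

eval-X : ∀ x → eval X x ≡ x
eval-X x = trans (ℤ.+-identityˡ _) (trans (cong (x *ℤ_) (eval-constₚ 1ℤ x)) (ℤ.*-identityʳ x))

eval-^ₚ : ∀ P m x → eval (P ^ₚ m) x ≡ eval P x ^ℤ m
eval-^ₚ P zero    x = eval-constₚ 1ℤ x
eval-^ₚ P (suc m) x = trans (eval-*ₚ P (P ^ₚ m) x) (cong (eval P x *ℤ_) (eval-^ₚ P m x))

eval-X^-1 : ∀ N x → eval (X ^ₚ N -ₚ constₚ 1ℤ) x ≡ x ^ℤ N -ℤ 1ℤ
eval-X^-1 N x = trans (eval--ₚ (X ^ₚ N) (constₚ 1ℤ) x)
  (cong₂ _-ℤ_ (trans (eval-^ₚ X N x) (cong (_^ℤ N) (eval-X x))) (eval-constₚ 1ℤ x))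

eval-X-1^ : ∀ N x → eval (X-1 ^ₚ N) x ≡ (x -ℤ 1ℤ) ^ℤ N
eval-X-1^ N x = trans (eval-^ₚ X-1 N x)
  (cong (_^ℤ N) (trans (eval--ₚ X (constₚ 1ℤ) x) (cong₂ _-ℤ_ (eval-X x) (eval-constₚ 1ℤ x))))

eval-∣ : ∀ {d R} x → R ≈ [] [mod d ] → d ∣ₛ eval R x
eval-∣ {R = []}    x R≈0 = ∣ₛ-0
eval-∣ {R = r ∷ R} x R≈0 =
  Signed.∣m∣n⇒∣m+n (∣ₛ-resp-≡ (ℤ.+-identityʳ r) (coeff-∣ R≈0 0))
                   (Signed.∣n⇒∣m*n x (eval-∣ {R = R} x (coeffwise-mod λ k → coeff-∣ R≈0 (suc k))))

eval-cong-mod : ∀ {d P Q} x → P ≈ Q [mod d ] → d ∣ₛ eval P x -ℤ eval Q x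
eval-cong-mod {P = P} {Q} x P≈Q = ∣ₛ-resp-≡ (eval--ₚ P Q x) (eval-∣ x (≈[mod]⇒-ₚ≈[] P≈Q))

∣ₛ-by-ℤ-induction : ∀ {d} (g : ℤ → ℤ) → d ∣ₛ g 0ℤ → (∀ x → d ∣ₛ g x -ℤ g (x -ℤ 1ℤ)) → ∀ x → d ∣ₛ g x
∣ₛ-by-ℤ-induction {d} g base step = λ
  { (+ n)    → nonneg n
  ; -[1+ n ] → neg n
  }
  where
  cancel : ∀ a b → (a -ℤ b) +ℤ b ≡ a
  cancel = solve-∀
  cancel′ : ∀ a b → a -ℤ (a -ℤ b) ≡ b
  cancel′ = solve-∀
  nonneg : ∀ n → d ∣ₛ g (+ n)
  nonneg zero    = base
  nonneg (suc n) = ∣ₛ-resp-≡ (cancel (g (+ suc n)) (g (+ n))) (Signed.∣m∣n⇒∣m+n (step (+ suc n)) (nonneg n))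
  neg : ∀ n → d ∣ₛ g -[1+ n ]
  neg zero    = ∣ₛ-resp-≡ (cancel′ (g 0ℤ) (g -1ℤ)) (Signed.∣m∣n⇒∣m-n base (step 0ℤ))
  neg (suc n) = ∣ₛ-resp-≡ (trans (cancel′ (g -[1+ n ]) _) (cong (λ i → g -[1+ suc i ]) (ℕ.+-identityʳ n)))
                          (Signed.∣m∣n⇒∣m-n (neg n) (step -[1+ n ]))

-- Evaluated at x, the congruence says that f(x) = x^N - x satisfies f(x) ≡ f(x - 1), and f(0) = 0.
frobenius⇒fermat : ∀ {d} N → 0 < N → X-1 ^ₚ N ≈ X ^ₚ N -ₚ constₚ 1ℤ [mod d ] → ∀ x → d ∣ₛ x ^ℤ N -ℤ x
frobenius⇒fermat {d} (suc N) _ frob = ∣ₛ-by-ℤ-induction (λ x → x ^ℤ suc N -ℤ x) ∣ₛ-0 step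
  where
  regroup : ∀ x y z → -1ℤ *ℤ (y -ℤ (z -ℤ 1ℤ)) ≡ (z -ℤ x) -ℤ (y -ℤ (x -ℤ 1ℤ))
  regroup = solve-∀
  step : ∀ x → d ∣ₛ (x ^ℤ suc N -ℤ x) -ℤ ((x -ℤ 1ℤ) ^ℤ suc N -ℤ (x -ℤ 1ℤ))
  step x = ∣ₛ-resp-≡ (regroup x ((x -ℤ 1ℤ) ^ℤ suc N) (x ^ℤ suc N))
             (Signed.∣n⇒∣m*n -1ℤ (∣ₛ-resp-≡ (cong₂ _-ℤ_ (eval-X-1^ (suc N) x) (eval-X^-1 (suc N) x))
                                            (eval-cong-mod x frob)))

frobenius-prime : ∀ {p} → Prime p → 3 ≤ p → X-1 ^ₚ p ≈ X ^ₚ p -ₚ constₚ 1ℤ [mod + p ]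
frobenius-prime {p} p-prime 3≤p = subst (λ N → X-1 ^ₚ N ≈ X ^ₚ N -ₚ constₚ 1ℤ [mod + p ])
                                        (ℕ.*-identityʳ p) (frobenius-prime-power p-prime 3≤p 1)

fermat : ∀ {p} → Prime p → 3 ≤ p → ∀ x → + p ∣ₛ x ^ℤ p -ℤ x
fermat p-prime 3≤p = frobenius⇒fermat _ (ℕ.<-≤-trans (s≤s z≤n) 3≤p) (frobenius-prime p-prime 3≤p)

fermat-unit : ∀ {p a} → Prime p → 3 ≤ p → ¬ + p ∣ₛ a → + p ∣ₛ a ^ℤ (p ∸ 1) -ℤ 1ℤ
fermat-unit {zero}  _       ()  _
fermat-unit {suc p} {a} p-prime 3≤p p∤a =
  [ (λ p∣a → ⊥-elim (p∤a (Signed.∣ᵤ⇒∣ p∣a))) , Signed.∣ᵤ⇒∣ ]′ (euclidsLemma ∣ a ∣ ∣ a ^ℤ p -ℤ 1ℤ ∣ p-prime p∣∣a∣*∣a^p-1∣)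
  where
  factor : ∀ a b → a *ℤ b -ℤ a ≡ a *ℤ (b -ℤ 1ℤ)
  factor = solve-∀
  p∣a*[a^p-1] : + suc p ∣ₛ a *ℤ (a ^ℤ p -ℤ 1ℤ)
  p∣a*[a^p-1] = ∣ₛ-resp-≡ (factor a (a ^ℤ p)) (fermat p-prime 3≤p a)
  p∣∣a∣*∣a^p-1∣ : suc p ∣ℕ ∣ a ∣ * ∣ a ^ℤ p -ℤ 1ℤ ∣
  p∣∣a∣*∣a^p-1∣ = subst (suc p ∣ℕ_) (ℤ.abs-* a (a ^ℤ p -ℤ 1ℤ)) (Signed.∣⇒∣ᵤ p∣a*[a^p-1])

∣x-1⇒∣x^m-1 : ∀ {d x} → d ∣ₛ x -ℤ 1ℤ → ∀ m → d ∣ₛ x ^ℤ m -ℤ 1ℤ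
∣x-1⇒∣x^m-1 d∣x-1 zero    = ∣ₛ-0
∣x-1⇒∣x^m-1 {x = x} d∣x-1 (suc m) =
  ∣ₛ-resp-≡ (telescope x (x ^ℤ m)) (Signed.∣m∣n⇒∣m+n (Signed.∣n⇒∣m*n x (∣x-1⇒∣x^m-1 d∣x-1 m)) d∣x-1)
  where
  telescope : ∀ x y → x *ℤ (y -ℤ 1ℤ) +ℤ (x -ℤ 1ℤ) ≡ x *ℤ y -ℤ 1ℤ
  telescope = solve-∀

Der-+-*-mod-frobenius : ∀ {d N} → d ∣ₛ + N → X-1 ^ₚ N ≈ X ^ₚ N -ₚ constₚ 1ℤ [mod d ] →
                        ∀ m n → Der (n + m * N) ≈ (X ^ₚ N -ₚ constₚ 1ℤ) ^ₚ m *ₚ Der n [mod d ]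
Der-+-*-mod-frobenius d∣N frob m n =
  ≈[mod]-trans (Der-+-*-mod d∣N m n) (*ₚ-congʳ-mod (Der n) (^ₚ-cong-mod m frob))

eval-X^-1^*ₚ : ∀ N m P x → eval ((X ^ₚ N -ₚ constₚ 1ℤ) ^ₚ m *ₚ P) x ≡ (x ^ℤ N -ℤ 1ℤ) ^ℤ m *ℤ eval P x
eval-X^-1^*ₚ N m P x = trans (eval-*ₚ ((X ^ₚ N -ₚ constₚ 1ℤ) ^ₚ m) P x)
  (cong (_*ℤ eval P x) (trans (eval-^ₚ (X ^ₚ N -ₚ constₚ 1ℤ) m x) (cong (_^ℤ m) (eval-X^-1 N x))))

Der-eval-periodic : ∀ {p q} → Prime p → 3 ≤ p → ¬ + p ∣ₛ q -ℤ 1ℤ → ∀ m n →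
                    + p ∣ₛ eval (Der (n + m * (p * (p ∸ 1)))) q -ℤ eval (Der n) q
Der-eval-periodic {p} {q} p-prime 3≤p p∤q-1 m n =
  subst (λ i → + p ∣ₛ eval (Der i) q -ℤ E) (sym index)
    (∣ₛ-resp-≡ (combine L (c ^ℤ m) E)
      (Signed.∣m∣n⇒∣m+n shifted (Signed.∣m⇒∣m*n E (∣x-1⇒∣x^m-1 (fermat-unit p-prime 3≤p p∤a) m))))
  where
  a c E L : ℤ
  a = q ^ℤ p -ℤ 1ℤ
  c = a ^ℤ (p ∸ 1)
  E = eval (Der n) q
  L = eval (Der (n + m * (p ∸ 1) * p)) q
  p∤a : ¬ + p ∣ₛ a
  p∤a p∣a = p∤q-1 (∣ₛ-resp-≡ (cancel q (q ^ℤ p)) (Signed.∣m∣n⇒∣m-n p∣a (fermat p-prime 3≤p q)))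
    where
    cancel : ∀ q r → (r -ℤ 1ℤ) -ℤ (r -ℤ q) ≡ q -ℤ 1ℤ
    cancel = solve-∀
  index : n + m * (p * (p ∸ 1)) ≡ n + m * (p ∸ 1) * p
  index = cong (λ i → n + i) (reassoc m p (p ∸ 1))
    where
    reassoc : ∀ m p r → m * (p * r) ≡ m * r * p
    reassoc = ℕ-Solver.solve-∀
  evaluated : eval ((X ^ₚ p -ₚ constₚ 1ℤ) ^ₚ (m * (p ∸ 1)) *ₚ Der n) q ≡ c ^ℤ m *ℤ E
  evaluated = trans (eval-X^-1^*ₚ p (m * (p ∸ 1)) (Der n) q) (cong (_*ℤ E) (begin
    a ^ℤ (m * (p ∸ 1))   ≡⟨ cong (a ^ℤ_) (ℕ.*-comm m (p ∸ 1)) ⟩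
    a ^ℤ ((p ∸ 1) * m)   ≡⟨ ℤ.^-*-assoc a (p ∸ 1) m ⟨
    c ^ℤ m               ∎))
    where open ≡-Reasoning
  congruence : Der (n + m * (p ∸ 1) * p) ≈ (X ^ₚ p -ₚ constₚ 1ℤ) ^ₚ (m * (p ∸ 1)) *ₚ Der n [mod + p ]
  congruence = Der-+-*-mod-frobenius (Signed.∣-refl {+ p}) (frobenius-prime p-prime 3≤p) (m * (p ∸ 1)) n
  shifted : + p ∣ₛ L -ℤ c ^ℤ m *ℤ E
  shifted = subst (λ y → + p ∣ₛ L -ℤ y) evaluated (eval-cong-mod q congruence)
  combine : ∀ x c e → (x -ℤ c *ℤ e) +ℤ (c -ℤ 1ℤ) *ℤ e ≡ x -ℤ e
  combine = solve-∀

≈[mod]⇒≡ₚ[mod] : ∀ {P Q p} → P ≈ Q [mod + p ] → P ≡ₚ Q [mod p ]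
≈[mod]⇒≡ₚ[mod] {P} {Q} P≈Q k = Signed.∣⇒∣ᵤ (∣ₛ-resp-≡ (sym (coeff-- P Q k)) (coeff-∣ P≈Q k))

Der-congruence : ∀ {p s} → Prime p → 3 ≤ p → 1 ≤ s → ∀ m n →
                 Der (n + m * p ^ s) ≈ (X ^ₚ (p ^ s) -ₚ constₚ 1ℤ) ^ₚ m *ₚ Der n [mod + p ]
Der-congruence {p} {suc s} p-prime 3≤p _ =
  Der-+-*-mod-frobenius (Signed.∣ᵤ⇒∣ (ℕ∣.m∣m*n (p ^ s))) (frobenius-prime-power p-prime 3≤p (suc s))

derNum-congruence : ∀ {p s} → Prime p → 3 ≤ p → 1 ≤ s → ∀ m n →
                    + p ∣ₛ derNum (n + m * p ^ s) -ℤ -1ℤ ^ℤ m *ℤ derNum n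
derNum-congruence {p} {s} p-prime 3≤p 1≤s m n =
  subst (λ y → + p ∣ₛ derNum (n + m * p ^ s) -ℤ y) evaluated (eval-cong-mod 0ℤ congruence)
  where
  instance
    p≢0 : NonZero p
    p≢0 = prime⇒nonZero p-prime
  congruence : Der (n + m * p ^ s) ≈ (X ^ₚ (p ^ s) -ₚ constₚ 1ℤ) ^ₚ m *ₚ Der n [mod + p ]
  congruence = Der-congruence p-prime 3≤p 1≤s m n
  0^N-1≡-1 : ∀ N → 0 < N → 0ℤ ^ℤ N -ℤ 1ℤ ≡ -1ℤ
  0^N-1≡-1 (suc N) _ = refl
  evaluated : eval ((X ^ₚ (p ^ s) -ₚ constₚ 1ℤ) ^ₚ m *ₚ Der n) 0ℤ ≡ -1ℤ ^ℤ m *ℤ derNum n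
  evaluated = trans (eval-X^-1^*ₚ (p ^ s) m (Der n) 0ℤ)
                    (cong (λ x → x ^ℤ m *ℤ derNum n) (0^N-1≡-1 (p ^ s) (ℕ.m^n>0 p s)))

corollary2 :
    (∀ (n s m p : ℕ) → 1 ≤ n → 1 ≤ s → Prime p → 3 ≤ p →
      Der (n + m * p ^ s) ≡ₚ ((X ^ₚ (p ^ s)) -ₚ constₚ 1ℤ) ^ₚ m *ₚ Der n [mod p ])
    × (∀ (n s m p : ℕ) → 1 ≤ n → 1 ≤ s → Prime p → 3 ≤ p →
      derNum (n + m * p ^ s) ≡ᵢ (-1ℤ ^ℤ m) *ℤ derNum n [mod p ])
    × (∀ (n m p : ℕ) (q : ℤ) → 1 ≤ n → Prime p → 3 ≤ p → ¬ ((+ p) ∣ (q -ℤ 1ℤ)) →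
      eval (Der (n + m * (p * (p ∸ 1)))) q ≡ᵢ eval (Der n) q [mod p ])
    × (∀ (n : ℕ) → 3 ≤ n →
      Der n ≐ (sumRange 1 (n ∸ 3) (λ i → (+ (n ∸ i)) ·ₚ Der (n ∸ i))
               +ₚ (+ 3) ·ₚ Der 2
               +ₚ sumRange 3 n (λ i → (X -ₚ constₚ 1ℤ) ^ₚ i)))
-- None of the three congruences needs the hypothesis 1 ≤ n.
corollary2 =
    (λ n s m p _ 1≤s p-prime 3≤p → ≈[mod]⇒≡ₚ[mod] (Der-congruence p-prime 3≤p 1≤s m n))
  , (λ n s m p _ 1≤s p-prime 3≤p → Signed.∣⇒∣ᵤ (derNum-congruence p-prime 3≤p 1≤s m n))
  , (λ n m p q _ p-prime 3≤p p∤q-1 →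
       Signed.∣⇒∣ᵤ (Der-eval-periodic {q = q} p-prime 3≤p (p∤q-1 ∘ Signed.∣⇒∣ᵤ) m n))
  , λ { (suc (suc (suc k))) (s≤s (s≤s (s≤s _))) → coeff-≡ (Der-expansion k) }
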